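{- Let $n\ge 1$ and $m\ge 2$ be integers, let $G$ be a finite region-connected $n$-simplex graph with chromatic number $\chi(G)=n+1$ and $v=|V(G)|$ vertices, and let $c:V(G)\to\{0,1,\dots,n\}$ be a proper vertex coloring of $G$. On the set of all labelings $V(G)\to\mathbb{Z}_m$, define $L_1\sim L_2$ if $P_c[L_1]=P_c[L_2]$. Then each equivalence class of $\sim$ contains exactly $m^{v-n}$ labelings.
   Context: All graphs are finite simple graphs. An $n$-simplex of a graph $G$ is a set of $n+1$ vertices of $G$ that are pairwise adjacent. $G$ is an $n$-simplex graph if $G$ is a union of complete subgraphs on $n+1$ vertices (every vertex and every edge of $G$ lies in some $n$-simplex of $G$). Two $n$-simplexes $S,S'$ are adjacent if $|S\cap S'|=n$; $G$ is region-connected if for any two $n$-simplexes $S,S'$ there is a sequence $S=S_1,S_2,\dots,S_t=S'$ of $n$-simplexes with $S_j$ adjacent to $S_{j+1}$ for all $j$. A labeling is a map $L:V(G)\to\mathbb{Z}_m$. Let $\zeta=e^{2\pi i/m}$. For $0\le k<n$ let $i_k$ be the $n\times n$ complex diagonal matrix with $\zeta$ in diagonal position $k+1$ and $1$ in all other diagonal positions, and let $i_n=\zeta^{m-1}I_n$. For a proper coloring $c:V(G)\to\{0,\dots,n\}$ and a labeling $L$, define $P_c[L]=\prod_{v\in V(G)} i_{c(v)}^{\,L(v)}$ (well defined since these matrices commute and satisfy $i_k^m=I_n$). -}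

module Defs where

open import Data.Nat using (_≤_; ℕ; zero; suc; _+_; _*_; _∸_; NonZero)
open import Data.Nat.DivMod using (_%_; m%n<n)
open import Data.Fin using (fromℕ<; Fin; toℕ; inject₁; fromℕ)
open import Data.Fin.Subset using (Subset; _∈_; _∩_; ∣_∣)
open import Data.Vec using (Vec; lookup; tabulate)
open import Data.Bool using (Bool; true; false; if_then_else_)
open import Data.Product using (Σ; _×_; ∃; _,_; proj₁)
open import Relation.Binary.PropositionalEquality using (_≡_; _≢_)
open import Relation.Binary.Construct.Closure.ReflexiveTransitive using (Star)
open import Relation.Nullary using (¬_; does)
import Data.Fin.Properties as FinP

record Graph (v : ℕ) : Set where
  field
    adj     : Fin v → Fin v → Bool
    symm    : ∀ x y → adj x y ≡ true → adj y x ≡ true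
    irrefl  : ∀ x → adj x x ≡ false

module _ {v : ℕ} (G : Graph v) where
  open Graph G

  Adj : Fin v → Fin v → Set
  Adj x y = adj x y ≡ true

  IsSimplex : ℕ → Subset v → Set
  IsSimplex n S = (∣ S ∣ ≡ suc n) × (∀ x y → x ∈ S → y ∈ S → x ≢ y → Adj x y)

  Simplex : ℕ → Set
  Simplex n = Σ (Subset v) (IsSimplex n)

  AdjSimplex : (n : ℕ) → Simplex n → Simplex n → Set
  AdjSimplex n (S , _) (T , _) = ∣ S ∩ T ∣ ≡ n

  IsSimplexGraph : ℕ → Set
  IsSimplexGraph n =
    (∀ x → Σ (Simplex n) λ S → x ∈ proj₁ S) ×
    (∀ x y → Adj x y → Σ (Simplex n) λ S → (x ∈ proj₁ S) × (y ∈ proj₁ S))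

  RegionConnected : ℕ → Set
  RegionConnected n = (S T : Simplex n) → Star (AdjSimplex n) S T

  IsProper : {k : ℕ} → (Fin v → Fin k) → Set
  IsProper c = ∀ x y → Adj x y → c x ≢ c y

  Colorable : ℕ → Set
  Colorable k = Σ (Fin v → Fin k) IsProper

  HasChromaticNumber : ℕ → Set
  HasChromaticNumber k = Colorable k × (∀ j → suc j ≤ k → ¬ Colorable j)

-- Diagonal n×n matrices whose entries are powers of ζ = e^{2πi/m} are
-- represented by their exponent vectors in ℤ_m = Fin m:
-- a : Vec (Fin m) n stands for diag(ζ^{a_1}, …, ζ^{a_n}).  The map is an
-- injective group homomorphism (ζ is a primitive m-th root of unity), so
-- equality of matrices is equality of exponent vectors.

-- Exponent of ζ at diagonal position j of the generator i_k.
-- For k < n: i_k = diag with ζ at position k+1 (index j = k), 1 elsewhere.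
-- For k = n: i_n = ζ^{m-1} I_n.
genExp : (n m : ℕ) → Fin (suc n) → Fin n → ℕ
genExp n m k j =
  if does (k FinP.≟ inject₁ j) then 1
  else if does (k FinP.≟ fromℕ n) then m ∸ 1
  else 0

sumFin : (v : ℕ) → (Fin v → ℕ) → ℕ
sumFin zero    f = 0
sumFin (suc v) f = f Data.Fin.zero + sumFin v (λ x → f (Data.Fin.suc x))

Labeling : ℕ → ℕ → Set
Labeling v m = Vec (Fin m) v

-- P_c[L] = ∏_u i_{c(u)}^{L(u)}, as an exponent vector (mod m).
P : {v n : ℕ} (m : ℕ) {{_ : NonZero m}} → (Fin v → Fin (suc n)) → Labeling v m → Vec (Fin m) n
P {v} {n} m c L =
  tabulate λ j → fromℕ< (m%n<n (sumFin v (λ u → toℕ (lookup L u) * genExp n m (c u) j)) m)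

{-# OPTIONS --safe #-}
-- Identify a labeling with a vector in ℤ_m^v.  Then L ↦ P_c[L] is the linear map
-- ℤ_m^v → ℤ_m^n whose matrix has row e_k for each vertex of colour k < n.  Since
-- χ(G) = n + 1, every colour occurs, so the matrix contains the identity rows.
-- Eliminating one pivot vertex together with its coordinate keeps this shape and
-- leaves exactly one admissible value for the pivot label, so every fibre is in
-- bijection with the labelings of the v − n remaining vertices.
module Submission where

open import Defs
open import Data.Nat using (ℕ; suc; _≤_; _^_; _∸_; NonZero)
open import Data.Fin using (Fin)
open import Data.Vec using (Vec)
open import Data.Product using (Σ)
open import Relation.Binary.PropositionalEquality using (_≡_)
open import Function.Bundles using (_⤖_)

open import Axiom.UniquenessOfIdentityProofs using (module Decidable⇒UIP)
open import Data.Empty using (⊥-elim)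
open import Data.Fin using (zero; suc; toℕ; punchIn; punchOut; inject₁; fromℕ; _≟_)
open import Data.Fin.Properties
  using (suc-injective; any?; toℕ-fromℕ<; toℕ-injective; toℕ<n; punchIn-punchOut; punchOut-injective;
         inject₁-injective; fromℕ≢inject₁; *↔×)
open import Data.Nat using (zero; _+_; _*_; pred)
open import Data.Nat.DivMod using (_%_; _mod_; %-distribˡ-+; m%n%n≡m%n; [m+kn]%n≡m%n; m<n⇒m%n≡m)
open import Data.Nat.Properties using (+-assoc; +-comm; *-suc; *-identityʳ; *-zeroʳ; suc-pred; ≤-refl)
open import Data.Product using (_×_; _,_; proj₁; proj₂; ∃)
open import Data.Product.Function.NonDependent.Propositional using (_×-↔_)
open import Data.Vec using ([]; _∷_; lookup; tabulate; tail; insertAt; removeAt; uncons)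
open import Data.Vec.Properties
  using (≡-dec; ∷-injectiveˡ; ∷-injectiveʳ; tabulate-cong; insertAt-lookup; insertAt-punchIn;
         insertAt-removeAt; removeAt-insertAt)
open import Function.Base using (_∘_)
open import Function.Bundles using (_↔_; mk↔ₛ′)
open import Function.Properties.Inverse using (↔-refl; ↔-sym; ↔-trans; ↔⇒⤖)
open import Relation.Binary.Definitions using (DecidableEquality)
open import Relation.Binary.PropositionalEquality using (refl; sym; trans; cong; cong₂; _≢_; module ≡-Reasoning)
open import Relation.Nullary using (yes; no)
open import Relation.Nullary.Decidable using (dec-true; dec-false)

open ≡-Reasoning

Fiber : {A B : Set} → (A → B) → B → Set
Fiber {A} f b = Σ A λ a → f a ≡ b

module _ {A B : Set} (_≟B_ : DecidableEquality B) {f : A → B} {b : B} where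

  fiber-≡ : {x y : Fiber f b} → proj₁ x ≡ proj₁ y → x ≡ y
  fiber-≡ {x , p} {.x , q} refl = cong (x ,_) (Decidable⇒UIP.≡-irrelevant _≟B_ p q)

fiber-↔ : {A A′ B B′ : Set} → DecidableEquality B → DecidableEquality B′ →
          {f : A → B} {b : B} {f′ : A′ → B′} {b′ : B′} →
          (to : Fiber f b → Fiber f′ b′) (from : Fiber f′ b′ → Fiber f b) →
          (∀ y → proj₁ (to (from y)) ≡ proj₁ y) → (∀ x → proj₁ (from (to x)) ≡ proj₁ x) →
          Fiber f b ↔ Fiber f′ b′
fiber-↔ _≟B_ _≟B′_ to from to∘from from∘to =
  mk↔ₛ′ to from (λ y → fiber-≡ _≟B′_ (to∘from y)) (λ x → fiber-≡ _≟B_ (from∘to x))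

fiber-[] : {A X : Set} (f : A → Vec X 0) → Fiber f [] ↔ A
fiber-[] f = mk↔ₛ′ proj₁ (λ a → a , is-[] (f a)) (λ _ → refl) (λ (a , eq) → cong (a ,_) (is-[]-unique eq))
  where
  is-[] : ∀ xs → xs ≡ []
  is-[] [] = refl
  is-[]-unique : ∀ {xs} (eq : xs ≡ []) → is-[] xs ≡ eq
  is-[]-unique refl = refl

Vec↔Fin^ : ∀ {m} v → Vec (Fin m) v ↔ Fin (m ^ v)
Vec↔Fin^ zero    = mk↔ₛ′ (λ _ → zero) (λ _ → []) (λ { zero → refl }) (λ { [] → refl })
Vec↔Fin^ (suc v) = ↔-trans uncons↔ (↔-trans (↔-refl ×-↔ Vec↔Fin^ v) (↔-sym *↔×))
  where
  uncons↔ : Vec _ (suc v) ↔ (_ × Vec _ v)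
  uncons↔ = mk↔ₛ′ uncons (λ (a , L) → a ∷ L) (λ _ → refl) (λ { (a ∷ L) → refl })

sumFin-cong : ∀ v {f f′ : Fin v → ℕ} → (∀ u → f u ≡ f′ u) → sumFin v f ≡ sumFin v f′
sumFin-cong zero    f≗f′ = refl
sumFin-cong (suc v) f≗f′ = cong₂ _+_ (f≗f′ zero) (sumFin-cong v (f≗f′ ∘ suc))

sumFin-punchIn : ∀ v (f : Fin (suc v) → ℕ) p → sumFin (suc v) f ≡ f p + sumFin v (f ∘ punchIn p)
sumFin-punchIn v       f zero    = refl
sumFin-punchIn (suc v) f (suc p) = begin
  f zero + sumFin (suc v) (f ∘ suc)   ≡⟨ cong (f zero +_) (sumFin-punchIn v (f ∘ suc) p) ⟩
  f zero + (f (suc p) + rest)         ≡⟨ sym (+-assoc (f zero) (f (suc p)) rest) ⟩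
  f zero + f (suc p) + rest           ≡⟨ cong (_+ rest) (+-comm (f zero) (f (suc p))) ⟩
  f (suc p) + f zero + rest           ≡⟨ +-assoc (f (suc p)) (f zero) rest ⟩
  f (suc p) + (f zero + rest)         ∎
  where
  rest : ℕ
  rest = sumFin v (f ∘ suc ∘ punchIn p)

record HasIdentityRows {v n : ℕ} (g : Fin v → Fin n → ℕ) : Set where
  field
    pivot    : Fin n → Fin v
    pivot-≡  : ∀ k → g (pivot k) k ≡ 1
    pivot-≢  : ∀ {k j} → k ≢ j → g (pivot k) j ≡ 0

module _ {v n : ℕ} {g : Fin (suc v) → Fin (suc n) → ℕ} (rows : HasIdentityRows g) where
  open HasIdentityRows rows

  dropPivot : Fin v → Fin n → ℕ
  dropPivot u j = g (punchIn (pivot zero) u) (suc j)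

  dropPivot-hasIdentityRows : HasIdentityRows dropPivot
  dropPivot-hasIdentityRows = record
    { pivot   = λ j → punchOut (pivot₀≢pivot j)
    ; pivot-≡ = λ j → trans (cong (λ u → g u (suc j)) (punchIn-punchOut (pivot₀≢pivot j))) (pivot-≡ (suc j))
    ; pivot-≢ = λ {k} {j} k≢j → trans (cong (λ u → g u (suc j)) (punchIn-punchOut (pivot₀≢pivot k)))
                                      (pivot-≢ (k≢j ∘ suc-injective))
    }
    where
    pivot₀≢pivot : ∀ j → pivot zero ≢ pivot (suc j)
    pivot₀≢pivot j eq with () ← trans (sym (pivot-≡ zero)) (trans (cong (λ u → g u zero) eq) (pivot-≢ λ ()))

[m%d+n]%d≡[m+n]%d : ∀ m n d .{{_ : NonZero d}} → (m % d + n) % d ≡ (m + n) % d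
[m%d+n]%d≡[m+n]%d m n d = begin
  (m % d + n) % d           ≡⟨ %-distribˡ-+ (m % d) n d ⟩
  (m % d % d + n % d) % d   ≡⟨ cong (λ r → (r + n % d) % d) (m%n%n≡m%n m d) ⟩
  (m % d + n % d) % d       ≡⟨ %-distribˡ-+ m n d ⟨
  (m + n) % d               ∎

module _ {m : ℕ} .{{_ : NonZero m}} where

  toℕ-mod : ∀ x → toℕ (x mod m) ≡ x % m
  toℕ-mod x = toℕ-fromℕ< _

  n+n*pred[m]≡n*m : ∀ n → n + n * pred m ≡ n * m
  n+n*pred[m]≡n*m n = trans (sym (*-suc n (pred m))) (cong (n *_) (suc-pred m))

  -- x * pred m is an additive inverse of x modulo m.
  _⊖_ : Fin m → ℕ → Fin m
  t ⊖ x = (toℕ t + x * pred m) mod m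

  infixl 6 _⊖_

  ⊖-solves : ∀ t x → (toℕ (t ⊖ x) + x) mod m ≡ t
  ⊖-solves t x = toℕ-injective (begin
    toℕ ((toℕ (t ⊖ x) + x) mod m)           ≡⟨ toℕ-mod _ ⟩
    (toℕ (t ⊖ x) + x) % m                   ≡⟨ cong (λ r → (r + x) % m) (toℕ-mod _) ⟩
    ((toℕ t + x * pred m) % m + x) % m      ≡⟨ [m%d+n]%d≡[m+n]%d (toℕ t + x * pred m) x m ⟩
    (toℕ t + x * pred m + x) % m            ≡⟨ cong (_% m) (+-assoc (toℕ t) _ x) ⟩
    (toℕ t + (x * pred m + x)) % m          ≡⟨ cong (λ y → (toℕ t + y) % m) (+-comm (x * pred m) x) ⟩
    (toℕ t + (x + x * pred m)) % m          ≡⟨ cong (λ y → (toℕ t + y) % m) (n+n*pred[m]≡n*m x) ⟩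
    (toℕ t + x * m) % m                     ≡⟨ [m+kn]%n≡m%n (toℕ t) x m ⟩
    toℕ t % m                               ≡⟨ m<n⇒m%n≡m (toℕ<n t) ⟩
    toℕ t                                   ∎)

  ⊖-unique : ∀ {a t x} → (toℕ a + x) mod m ≡ t → t ⊖ x ≡ a
  ⊖-unique {a} {t} {x} refl = toℕ-injective (begin
    toℕ (((toℕ a + x) mod m) ⊖ x)              ≡⟨ toℕ-mod _ ⟩
    (toℕ ((toℕ a + x) mod m) + x * pred m) % m ≡⟨ cong (λ r → (r + x * pred m) % m) (toℕ-mod _) ⟩
    ((toℕ a + x) % m + x * pred m) % m         ≡⟨ [m%d+n]%d≡[m+n]%d (toℕ a + x) (x * pred m) m ⟩
    (toℕ a + x + x * pred m) % m               ≡⟨ cong (_% m) (+-assoc (toℕ a) x _) ⟩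
    (toℕ a + (x + x * pred m)) % m             ≡⟨ cong (λ y → (toℕ a + y) % m) (n+n*pred[m]≡n*m x) ⟩
    (toℕ a + x * m) % m                        ≡⟨ [m+kn]%n≡m%n (toℕ a) x m ⟩
    toℕ a % m                                  ≡⟨ m<n⇒m%n≡m (toℕ<n a) ⟩
    toℕ a                                      ∎)

  columnSum : ∀ {v n} → (Fin v → Fin n → ℕ) → Labeling v m → Fin n → ℕ
  columnSum {v} g L j = sumFin v (λ u → toℕ (lookup L u) * g u j)

  -- P m c is definitionally linearMap (λ u → genExp n m (c u)).
  linearMap : ∀ {v n} → (Fin v → Fin n → ℕ) → Labeling v m → Vec (Fin m) n
  linearMap g L = tabulate (λ j → columnSum g L j mod m)

  columnSum-insertAt : ∀ {v n} (g : Fin (suc v) → Fin n → ℕ) L p a j →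
                       columnSum g (insertAt L p a) j ≡ toℕ a * g p j + columnSum (g ∘ punchIn p) L j
  columnSum-insertAt {v} g L p a j = begin
    columnSum g (insertAt L p a) j
      ≡⟨ sumFin-punchIn v (λ u → toℕ (lookup (insertAt L p a) u) * g u j) p ⟩
    toℕ (lookup (insertAt L p a) p) * g p j + sumFin v (λ u → toℕ (lookup (insertAt L p a) (punchIn p u)) * g (punchIn p u) j)
      ≡⟨ cong₂ _+_ (cong (λ b → toℕ b * g p j) (insertAt-lookup L p a))
                   (sumFin-cong v (λ u → cong (λ b → toℕ b * g (punchIn p u) j) (insertAt-punchIn L p a u))) ⟩
    toℕ a * g p j + columnSum (g ∘ punchIn p) L j
      ∎

  module _ {v n : ℕ} {g : Fin (suc v) → Fin (suc n) → ℕ} (rows : HasIdentityRows g) where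
    open HasIdentityRows rows

    private
      p : Fin (suc v)
      p = pivot zero

    residual : Labeling v m → ℕ
    residual L = columnSum (g ∘ punchIn p) L zero

    linearMap-insertAt : ∀ L a → linearMap g (insertAt L p a) ≡
                         (toℕ a + residual L) mod m ∷ linearMap (dropPivot rows) L
    linearMap-insertAt L a = cong₂ _∷_ (cong (_mod m) pivotColumn) (tabulate-cong (cong (_mod m) ∘ otherColumn))
      where
      pivotColumn : columnSum g (insertAt L p a) zero ≡ toℕ a + residual L
      pivotColumn = begin
        columnSum g (insertAt L p a) zero   ≡⟨ columnSum-insertAt g L p a zero ⟩
        toℕ a * g p zero + residual L       ≡⟨ cong (λ y → toℕ a * y + residual L) (pivot-≡ zero) ⟩
        toℕ a * 1 + residual L              ≡⟨ cong (_+ residual L) (*-identityʳ (toℕ a)) ⟩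
        toℕ a + residual L                  ∎
      otherColumn : ∀ j → columnSum g (insertAt L p a) (suc j) ≡ columnSum (dropPivot rows) L j
      otherColumn j = begin
        columnSum g (insertAt L p a) (suc j)                  ≡⟨ columnSum-insertAt g L p a (suc j) ⟩
        toℕ a * g p (suc j) + columnSum (dropPivot rows) L j  ≡⟨ cong (λ y → toℕ a * y + rest) (pivot-≢ λ ()) ⟩
        toℕ a * 0 + columnSum (dropPivot rows) L j            ≡⟨ cong (_+ rest) (*-zeroʳ (toℕ a)) ⟩
        columnSum (dropPivot rows) L j                        ∎
        where
        rest : ℕ
        rest = columnSum (dropPivot rows) L j

    linearMap-removeAt : ∀ L → linearMap g L ≡
                         (toℕ (lookup L p) + residual (removeAt L p)) mod m ∷ linearMap (dropPivot rows) (removeAt L p)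
    linearMap-removeAt L =
      trans (cong (linearMap g) (sym (insertAt-removeAt L p))) (linearMap-insertAt (removeAt L p) (lookup L p))

    fiber-dropPivot : ∀ t → Fiber (linearMap g) t ↔ Fiber (linearMap (dropPivot rows)) (tail t)
    fiber-dropPivot (t₀ ∷ t) =
      fiber-↔ (≡-dec _≟_) (≡-dec _≟_) to from (λ (L , _) → removeAt-insertAt L p _) from∘to
      where
      to : Fiber (linearMap g) (t₀ ∷ t) → Fiber (linearMap (dropPivot rows)) t
      to (L , eq) = removeAt L p , ∷-injectiveʳ (trans (sym (linearMap-removeAt L)) eq)
      from : Fiber (linearMap (dropPivot rows)) t → Fiber (linearMap g) (t₀ ∷ t)
      from (L , eq) = insertAt L p (t₀ ⊖ residual L) ,
                      trans (linearMap-insertAt L _) (cong₂ _∷_ (⊖-solves t₀ (residual L)) eq)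
      from∘to : ∀ x → proj₁ (from (to x)) ≡ proj₁ x
      from∘to (L , eq) = trans (cong (insertAt (removeAt L p) p) (⊖-unique pivotColumn))
                               (insertAt-removeAt L p)
        where
        pivotColumn : (toℕ (lookup L p) + residual (removeAt L p)) mod m ≡ t₀
        pivotColumn = ∷-injectiveˡ (trans (sym (linearMap-removeAt L)) eq)

  fiber↔Fin^ : ∀ {v n} {g : Fin v → Fin n → ℕ} → HasIdentityRows g → (t : Vec (Fin m) n) →
               Fiber (linearMap g) t ↔ Fin (m ^ (v ∸ n))
  fiber↔Fin^ {v}     {zero} {g} _ [] = ↔-trans (fiber-[] (linearMap g)) (Vec↔Fin^ v)
  fiber↔Fin^ {zero}  {suc n}     rows t with () ← HasIdentityRows.pivot rows zero
  fiber↔Fin^ {suc v} {suc n}     rows t =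
    ↔-trans (fiber-dropPivot rows t) (fiber↔Fin^ (dropPivot-hasIdentityRows rows) (tail t))

-- A colour k missed by c could be punched out, giving a proper n-colouring.
colour-occurs : ∀ {v n} (G : Graph v) {c : Fin v → Fin (suc n)} → IsProper G c →
                HasChromaticNumber G (suc n) → ∀ k → ∃ λ u → c u ≡ k
colour-occurs {v} {n} G {c} proper (_ , notColourable) k with any? (λ u → c u ≟ k)
... | yes occurs = occurs
... | no missed  = ⊥-elim (notColourable n ≤-refl (c′ , proper′))
  where
  k≢c : ∀ u → k ≢ c u
  k≢c u eq = missed (u , sym eq)
  c′ : Fin v → Fin n
  c′ u = punchOut (k≢c u)
  proper′ : IsProper G c′
  proper′ x y adj eq = proper x y adj (punchOut-injective (k≢c x) (k≢c y) eq)

genExp-inject₁-≡ : ∀ n m k → genExp n m (inject₁ k) k ≡ 1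
genExp-inject₁-≡ n m k rewrite dec-true (inject₁ k ≟ inject₁ k) refl = refl

genExp-inject₁-≢ : ∀ n m {k j} → k ≢ j → genExp n m (inject₁ k) j ≡ 0
genExp-inject₁-≢ n m {k} {j} k≢j
  rewrite dec-false (inject₁ k ≟ inject₁ j) (k≢j ∘ inject₁-injective)
        | dec-false (inject₁ k ≟ fromℕ n) (fromℕ≢inject₁ ∘ sym) = refl

generators-hasIdentityRows : ∀ {v n} m (G : Graph v) (c : Fin v → Fin (suc n)) → IsProper G c →
                             HasChromaticNumber G (suc n) → HasIdentityRows (λ u → genExp n m (c u))
generators-hasIdentityRows {n = n} m G c proper χ = record
  { pivot   = λ k → proj₁ (occurs k)
  ; pivot-≡ = λ k → trans (cong (λ i → genExp n m i k) (proj₂ (occurs k))) (genExp-inject₁-≡ n m k)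
  ; pivot-≢ = λ {k} k≢j → trans (cong (λ i → genExp n m i _) (proj₂ (occurs k))) (genExp-inject₁-≢ n m k≢j)
  }
  where
  occurs : ∀ k → ∃ λ u → c u ≡ inject₁ k
  occurs k = colour-occurs G proper χ (inject₁ k)

corollary4p6p6 : (n m : ℕ) → 1 ≤ n → 2 ≤ m → {{_ : NonZero m}} →
    (v : ℕ) (G : Graph v) →
    RegionConnected G n → IsSimplexGraph G n → HasChromaticNumber G (suc n) →
    (c : Fin v → Fin (suc n)) → IsProper G c →
    (L : Labeling v m) →
    Σ (Labeling v m) (λ L′ → P m c L′ ≡ P m c L) ⤖ Fin (m ^ (v ∸ n))
corollary4p6p6 n m _ _ v G _ _ χ c proper L =
  ↔⇒⤖ (fiber↔Fin^ (generators-hasIdentityRows m G c proper χ) (P m c L))
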